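{- Let $\mathbf{LSC}$ be a labelled sequent calculus for a modal logic $\mathsf{L}$ (both over the modal language $\{\bot,\top,\vee,\wedge,\rightarrow,\Box\}$) with respect to a class $\mathcal{C}$ of Kripke models. If $\mathbf{LSC}$ has the Labelled Craig Interpolation Property (LCIP) / Labelled Lyndon Interpolation Property (LLIP), then $\mathsf{L}$ has the Craig Interpolation Property (CIP) / Lyndon Interpolation Property (LIP).
   Context: A labelled sequent has the form $\mathcal{R},\Gamma\Rightarrow\Delta$, where $\Gamma,\Delta$ are finite multisets of labelled formulas $i:\phi$ ($i\in\mathbb{N}$) and $\mathcal{R}$ is a multiset of relational atoms $iRj$. An interpretation of a sequent $S$ into a Kripke model $\mathcal{M}=(W,R,V)$ is a map from (a superset of) the labels of $S$ to $W$ respecting the atoms of $\mathcal{R}$; $S$ is true under it iff some $i:\phi\in\Gamma$ is false at the image of $i$ or some $j:\psi\in\Delta$ is true at the image of $j$; $S$ is valid in $\mathcal{C}$ iff true under all interpretations into models in $\mathcal{C}$. $\mathbf{LSC}$ is a calculus for $\mathsf{L}$ w.r.t. $\mathcal{C}$ iff it proves exactly the sequents valid in $\mathcal{C}$ (where $\mathsf{L}$ is complete w.r.t. $\mathcal{C}$). Multiformulas are generated by $\mho ::= i:\phi \mid (\mho \,\bar\vee\, \mho) \mid (\mho \,\bar\wedge\, \mho)$, where $\bar\vee$ and $\bar\wedge$ denote multiformula disjunction and conjunction; under an interpretation, $i:\phi$ holds iff $\phi$ holds at the image of $i$, and $\bar\wedge,\bar\vee$ behave classically. The atom set of a sequent or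 multiformula ignores $\mathcal{R}$ and labels. LCIP: whenever $\mathbf{LSC}$ proves $\mathcal{R},\Gamma,\Gamma'\Rightarrow\Delta,\Delta'$ (split as $\mathcal{R},\Gamma;\Gamma'\Rightarrow\Delta;\Delta'$), there is a multiformula $\mho$ such that (1) every propositional variable of $\mho$ occurs both in $\Gamma,\Delta$ and in $\Gamma',\Delta'$; (2) for every interpretation into a model in $\mathcal{C}$: if $\mho$ is false then $\mathcal{R},\Gamma\Rightarrow\Delta$ is true, and if $\mho$ is true then $\mathcal{R},\Gamma'\Rightarrow\Delta'$ is true; (3) all labels of $\mho$ occur in the sequent. LLIP: replace (1) by the polarity-sensitive condition that variables occurring positively in $\mho$ occur negatively in $\Gamma\Rightarrow\Delta$ and positively in $\Gamma'\Rightarrow\Delta'$, and variables occurring negatively in $\mho$ occur positively in $\Gamma\Rightarrow\Delta$ and negatively in $\Gamma'\Rightarrow\Delta'$ (polarity flips in antecedents). CIP/LIP for $\mathsf{L}$: every provable $\phi\rightarrow\psi$ has an interpolant $\theta$ with $\phi\rightarrow\theta$, $\theta\rightarrow\psi$ provable and variables (with polarities, for LIP) shared by $\phi$ and $\psi$. -}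

module Defs where

open import Data.Nat using (ℕ)
open import Data.Product using (Σ; _×_; _,_; ∃)
open import Data.Sum using (_⊎_)
open import Data.Empty using (⊥)
open import Data.Unit using (⊤)
open import Data.List using (List; _++_)
open import Data.List.Relation.Unary.Any using (Any)
open import Data.List.Membership.Propositional using (_∈_)
open import Relation.Nullary using (¬_)
open import Function.Bundles using (_⇔_)
open import Relation.Binary.PropositionalEquality using (_≡_)

data Fm : Set where
  var  : ℕ → Fm
  ⊥′   : Fm
  ⊤′   : Fm
  _∨′_ : Fm → Fm → Fm
  _∧′_ : Fm → Fm → Fm
  _⇒′_ : Fm → Fm → Fm
  □′   : Fm → Fm

data Pol : Set where
  pos neg : Pol

flip : Pol → Pol
flip pos = neg
flip neg = pos

data Occ : Pol → ℕ → Fm → Set where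
  here : ∀ {p} → Occ pos p (var p)
  ∨l   : ∀ {s p φ ψ} → Occ s p φ → Occ s p (φ ∨′ ψ)
  ∨r   : ∀ {s p φ ψ} → Occ s p ψ → Occ s p (φ ∨′ ψ)
  ∧l   : ∀ {s p φ ψ} → Occ s p φ → Occ s p (φ ∧′ ψ)
  ∧r   : ∀ {s p φ ψ} → Occ s p ψ → Occ s p (φ ∧′ ψ)
  ⇒l   : ∀ {s p φ ψ} → Occ (flip s) p φ → Occ s p (φ ⇒′ ψ)
  ⇒r   : ∀ {s p φ ψ} → Occ s p ψ → Occ s p (φ ⇒′ ψ)
  □o   : ∀ {s p φ} → Occ s p φ → Occ s p (□′ φ)

Var : ℕ → Fm → Set
Var p φ = Σ Pol λ s → Occ s p φ

record Model : Set₁ where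
  field
    W : Set
    R : W → W → Set
    V : ℕ → W → Set

open Model public

_⊨_at_ : (M : Model) → Fm → W M → Set
M ⊨ var p at w = V M p w
M ⊨ ⊥′ at w = ⊥
M ⊨ ⊤′ at w = ⊤
M ⊨ (φ ∨′ ψ) at w = (M ⊨ φ at w) ⊎ (M ⊨ ψ at w)
M ⊨ (φ ∧′ ψ) at w = (M ⊨ φ at w) × (M ⊨ ψ at w)
M ⊨ (φ ⇒′ ψ) at w = (M ⊨ φ at w) → (M ⊨ ψ at w)
M ⊨ □′ φ at w = ∀ v → R M w v → M ⊨ φ at v

Class : Set₂
Class = Model → Set₁

Valid : Class → Fm → Set₁
Valid C φ = ∀ M → C M → ∀ w → M ⊨ φ at w

-- A logic is represented by its set of theorems
Logic : Set₁
Logic = Fm → Set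

CompleteFor : Logic → Class → Set₁
CompleteFor L C = ∀ φ → L φ ⇔ Valid C φ

LFm : Set
LFm = ℕ × Fm

RAtom : Set
RAtom = ℕ × ℕ

record Sequent : Set where
  constructor ⟨_,_⇒_⟩
  field
    rel : List RAtom
    ant : List LFm
    suc : List LFm

open Sequent public

Respects : (M : Model) → (ℕ → W M) → List RAtom → Set
Respects M f ℛ = ∀ {i j} → (i , j) ∈ ℛ → R M (f i) (f j)

TrueLF : (M : Model) → (ℕ → W M) → LFm → Set
TrueLF M f (i , φ) = M ⊨ φ at f i

SeqTrue : (M : Model) → (ℕ → W M) → Sequent → Set
SeqTrue M f S = Any (λ a → ¬ TrueLF M f a) (ant S) ⊎ Any (TrueLF M f) (suc S)

SeqValid : Class → Sequent → Set₁
SeqValid C S = ∀ M → C M → (f : ℕ → W M) → Respects M f (rel S) → SeqTrue M f S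

-- A labelled sequent calculus is represented by its set of provable sequents
Calculus : Set₁
Calculus = Sequent → Set

CalculusFor : Calculus → Class → Set₁
CalculusFor LSC C = ∀ S → LSC S ⇔ SeqValid C S

data MF : Set where
  lab  : ℕ → Fm → MF
  _∨̄_  : MF → MF → MF
  _∧̄_  : MF → MF → MF

MTrue : (M : Model) → (ℕ → W M) → MF → Set
MTrue M f (lab i φ) = M ⊨ φ at f i
MTrue M f (m ∨̄ n) = MTrue M f m ⊎ MTrue M f n
MTrue M f (m ∧̄ n) = MTrue M f m × MTrue M f n

MOcc : Pol → ℕ → MF → Set
MOcc s p (lab i φ) = Occ s p φ
MOcc s p (m ∨̄ n) = MOcc s p m ⊎ MOcc s p n
MOcc s p (m ∧̄ n) = MOcc s p m ⊎ MOcc s p n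

MVar : ℕ → MF → Set
MVar p m = Σ Pol λ s → MOcc s p m

MLab : ℕ → MF → Set
MLab i (lab j φ) = i ≡ j
MLab i (m ∨̄ n) = MLab i m ⊎ MLab i n
MLab i (m ∧̄ n) = MLab i m ⊎ MLab i n

SLab : ℕ → Sequent → Set
SLab i S = Any (λ a → i ≡ Data.Product.proj₁ a ⊎ i ≡ Data.Product.proj₂ a) (rel S)
         ⊎ Any (λ a → i ≡ Data.Product.proj₁ a) (ant S)
         ⊎ Any (λ a → i ≡ Data.Product.proj₁ a) (suc S)

SVar : ℕ → Sequent → Set
SVar p S = Any (λ a → Var p (Data.Product.proj₂ a)) (ant S)
         ⊎ Any (λ a → Var p (Data.Product.proj₂ a)) (suc S)

SOcc : Pol → ℕ → Sequent → Set
SOcc s p S = Any (λ a → Occ (flip s) p (Data.Product.proj₂ a)) (ant S)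
           ⊎ Any (λ a → Occ s p (Data.Product.proj₂ a)) (suc S)

Whole : List RAtom → List LFm → List LFm → List LFm → List LFm → Sequent
Whole ℛ Γ Γ' Δ Δ' = ⟨ ℛ , Γ ++ Γ' ⇒ Δ ++ Δ' ⟩

InterpSem : Class → List RAtom → List LFm → List LFm → List LFm → List LFm → MF → Set₁
InterpSem C ℛ Γ Γ' Δ Δ' m =
    (∀ M → C M → (f : ℕ → W M) → Respects M f ℛ →
        (¬ MTrue M f m → SeqTrue M f ⟨ ℛ , Γ ⇒ Δ ⟩)
      × (MTrue M f m → SeqTrue M f ⟨ ℛ , Γ' ⇒ Δ' ⟩))
  × (∀ i → MLab i m → SLab i (Whole ℛ Γ Γ' Δ Δ'))

LCIP : Calculus → Class → Set₁
LCIP LSC C = ∀ ℛ Γ Γ' Δ Δ' → LSC (Whole ℛ Γ Γ' Δ Δ') →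
  Σ MF λ m →
      (∀ p → MVar p m → SVar p ⟨ ℛ , Γ ⇒ Δ ⟩ × SVar p ⟨ ℛ , Γ' ⇒ Δ' ⟩)
    × InterpSem C ℛ Γ Γ' Δ Δ' m

LLIP : Calculus → Class → Set₁
LLIP LSC C = ∀ ℛ Γ Γ' Δ Δ' → LSC (Whole ℛ Γ Γ' Δ Δ') →
  Σ MF λ m →
      (∀ p → MOcc pos p m → SOcc neg p ⟨ ℛ , Γ ⇒ Δ ⟩ × SOcc pos p ⟨ ℛ , Γ' ⇒ Δ' ⟩)
    × (∀ p → MOcc neg p m → SOcc pos p ⟨ ℛ , Γ ⇒ Δ ⟩ × SOcc neg p ⟨ ℛ , Γ' ⇒ Δ' ⟩)
    × InterpSem C ℛ Γ Γ' Δ Δ' m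

CIP : Logic → Set
CIP L = ∀ φ ψ → L (φ ⇒′ ψ) →
  Σ Fm λ θ → L (φ ⇒′ θ) × L (θ ⇒′ ψ) × (∀ p → Var p θ → Var p φ × Var p ψ)

LIP : Logic → Set
LIP L = ∀ φ ψ → L (φ ⇒′ ψ) →
  Σ Fm λ θ → L (φ ⇒′ θ) × L (θ ⇒′ ψ)
    × (∀ s p → Occ s p θ → Occ s p φ × Occ s p ψ)

-- A theorem φ ⇒′ ψ of L is valid in C, so the sequent 0:φ ⇒ 0:ψ is provable in LSC; split it as
-- 0:φ ; ⇒ ; 0:ψ and take a labelled interpolant m. Interpreting every label at a single world w
-- turns m into the formula erase m obtained by dropping its labels, so the semantic clauses of m
-- say that φ ⇒′ erase m and erase m ⇒′ ψ are valid in C, hence theorems of L. Every variable of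
-- erase m occurs in m with the same polarity, and since polarity flips in the antecedent, a
-- negative occurrence in the sequent 0:φ ⇒ is a positive one in φ.
-- Excluded middle turns "m false ⇒ φ false" into "φ ⇒ m", and decides which side of 0:φ ⇒ 0:ψ holds.
module Submission where

open import Defs
open import Data.Product using (_×_; _,_; proj₁; proj₂; map)
open import Data.Sum using (_⊎_; inj₁; inj₂)
open import Data.List using ([]; [_])
open import Data.List.Relation.Unary.Any using (Any; here)
open import Data.List.Relation.Unary.Any.Properties using (singleton⁻)
open import Relation.Nullary using (yes; no)
open import Relation.Nullary.Decidable using (decidable-stable)
open import Function.Bundles using (_⇔_; mk⇔; Equivalence)
open import Axiom.ExcludedMiddle using (ExcludedMiddle)
open import Level using (zero)

erase : MF → Fm
erase (lab i φ) = φ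
erase (m ∨̄ n) = erase m ∨′ erase n
erase (m ∧̄ n) = erase m ∧′ erase n

MOcc-erase : ∀ {s p} m → Occ s p (erase m) → MOcc s p m
MOcc-erase (lab i φ) o = o
MOcc-erase (m ∨̄ n) (∨l o) = inj₁ (MOcc-erase m o)
MOcc-erase (m ∨̄ n) (∨r o) = inj₂ (MOcc-erase n o)
MOcc-erase (m ∧̄ n) (∧l o) = inj₁ (MOcc-erase m o)
MOcc-erase (m ∧̄ n) (∧r o) = inj₂ (MOcc-erase n o)

MTrue-const⇔⊨erase : ∀ M w m → MTrue M (λ _ → w) m ⇔ M ⊨ erase m at w
MTrue-const⇔⊨erase M w m = mk⇔ (to m) (from m)
  where
  to : ∀ m → MTrue M (λ _ → w) m → M ⊨ erase m at w
  to (lab i φ) t = t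
  to (m ∨̄ n) (inj₁ t) = inj₁ (to m t)
  to (m ∨̄ n) (inj₂ t) = inj₂ (to n t)
  to (m ∧̄ n) (t , u) = to m t , to n u

  from : ∀ m → M ⊨ erase m at w → MTrue M (λ _ → w) m
  from (lab i φ) t = t
  from (m ∨̄ n) (inj₁ t) = inj₁ (from m t)
  from (m ∨̄ n) (inj₂ t) = inj₂ (from n t)
  from (m ∧̄ n) (t , u) = from m t , from n u

left-singleton⁻ : ∀ {a b} {A : Set a} {P Q : A → Set b} {x} → Any P [ x ] ⊎ Any Q [] → P x
left-singleton⁻ (inj₁ px) = singleton⁻ px

right-singleton⁻ : ∀ {a b} {A : Set a} {P Q : A → Set b} {y} → Any P [] ⊎ Any Q [ y ] → Q y
right-singleton⁻ (inj₂ qy) = singleton⁻ qy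

implicationSequent : Fm → Fm → Sequent
implicationSequent φ ψ = Whole [] [ 0 , φ ] [] [] [ 0 , ψ ]

module _ (em : ExcludedMiddle Level.zero) {C : Class} {φ ψ : Fm} where

  implicationSequent-valid : Valid C (φ ⇒′ ψ) → SeqValid C (implicationSequent φ ψ)
  implicationSequent-valid ⊨φ⇒ψ M cM f _ with em {M ⊨ φ at f 0}
  ... | yes φ-holds = inj₂ (here (⊨φ⇒ψ M cM (f 0) φ-holds))
  ... | no ¬φ-holds = inj₁ (here ¬φ-holds)

  erase-interpolant-valid : ∀ {m} → InterpSem C [] [ 0 , φ ] [] [] [ 0 , ψ ] m →
    Valid C (φ ⇒′ erase m) × Valid C (erase m ⇒′ ψ)
  erase-interpolant-valid {m} (sem , _) = φ⇒m , m⇒ψ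
    where
    φ⇒m : Valid C (φ ⇒′ erase m)
    φ⇒m M cM w φ-holds = Equivalence.to (MTrue-const⇔⊨erase M w m)
      (decidable-stable em λ ¬m → left-singleton⁻ (proj₁ (sem M cM (λ _ → w) (λ ())) ¬m) φ-holds)

    m⇒ψ : Valid C (erase m ⇒′ ψ)
    m⇒ψ M cM w m-holds = right-singleton⁻
      (proj₂ (sem M cM (λ _ → w) (λ ())) (Equivalence.from (MTrue-const⇔⊨erase M w m) m-holds))

module _ (em : ExcludedMiddle Level.zero) {L : Logic} {C : Class} {LSC : Calculus}
         (complete : CompleteFor L C) (calculus : CalculusFor LSC C) where

  implicationSequent-provable : ∀ {φ ψ} → L (φ ⇒′ ψ) → LSC (implicationSequent φ ψ)
  implicationSequent-provable ⊢φ⇒ψ = Equivalence.from (calculus _)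
    (implicationSequent-valid em (Equivalence.to (complete _) ⊢φ⇒ψ))

  erase-interpolant-provable : ∀ {φ ψ m} → InterpSem C [] [ 0 , φ ] [] [] [ 0 , ψ ] m →
    L (φ ⇒′ erase m) × L (erase m ⇒′ ψ)
  erase-interpolant-provable sem =
    map (Equivalence.from (complete _)) (Equivalence.from (complete _)) (erase-interpolant-valid em sem)

  LCIP⇒CIP : LCIP LSC C → CIP L
  LCIP⇒CIP lcip φ ψ ⊢φ⇒ψ with lcip [] [ 0 , φ ] [] [] [ 0 , ψ ] (implicationSequent-provable ⊢φ⇒ψ)
  ... | m , sharedVar , sem = erase m , proj₁ provable , proj₂ provable , eraseVar-shared
    where
    provable : L (φ ⇒′ erase m) × L (erase m ⇒′ ψ)
    provable = erase-interpolant-provable sem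

    eraseVar-shared : ∀ p → Var p (erase m) → Var p φ × Var p ψ
    eraseVar-shared p (s , o) = map left-singleton⁻ right-singleton⁻ (sharedVar p (s , MOcc-erase m o))

  LLIP⇒LIP : LLIP LSC C → LIP L
  LLIP⇒LIP llip φ ψ ⊢φ⇒ψ with llip [] [ 0 , φ ] [] [] [ 0 , ψ ] (implicationSequent-provable ⊢φ⇒ψ)
  ... | m , sharedPos , sharedNeg , sem = erase m , proj₁ provable , proj₂ provable , eraseOcc-shared
    where
    provable : L (φ ⇒′ erase m) × L (erase m ⇒′ ψ)
    provable = erase-interpolant-provable sem

    eraseOcc-shared : ∀ s p → Occ s p (erase m) → Occ s p φ × Occ s p ψ
    eraseOcc-shared pos p o = map left-singleton⁻ right-singleton⁻ (sharedPos p (MOcc-erase m o))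
    eraseOcc-shared neg p o = map left-singleton⁻ right-singleton⁻ (sharedNeg p (MOcc-erase m o))

theorem5p9 : ExcludedMiddle Level.zero →
    (L : Logic) (C : Class) (LSC : Calculus) →
    CompleteFor L C → CalculusFor LSC C →
    (LCIP LSC C → CIP L) × (LLIP LSC C → LIP L)
theorem5p9 em L C LSC complete calculus = LCIP⇒CIP em complete calculus , LLIP⇒LIP em complete calculus
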